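{- Let $G=(V,E)$ be a cocomparability graph with $|V|=n$ and let $\sigma=(u_1,u_2,\dots,u_n,u_{n+1})$ be an LDFS umbrella-free ordering of $V\cup\{u_{n+1}\}$, where $u_{n+1}$ is a dummy isolated vertex. Let $i,j\in\{1,\dots,n\}$ and suppose $u_i\in V(G(i,j))$, $u_x\in V(G(i+1,j))$, $u_y\in V(G(i+1,x-1))$, and $u_x\in N(u_i)$. Let $P_1$ be a normal path of $G(i+1,j)$ with $u_x$ as its last vertex and let $P_2$ be a normal path of $G(i+1,x-1)$ with $u_y$ as its last vertex. Then $P=(P_1,u_i,P_2)$ (the concatenation of $P_1$, the vertex $u_i$, and $P_2$) is a normal path of $G(i,j)$ with $u_y$ as its last vertex.
   Context: Graphs are finite, simple, undirected; $N(v)$ is the neighborhood of $v$ in $G$. A path $(v_1,\dots,v_k)$ is a sequence of distinct vertices with $v_iv_{i+1}\in E$. An ordering $\sigma$ is umbrella-free if for all $x<_\sigma y<_\sigma z$, $xz\in E$ implies $xy\in E$ or $yz\in E$. For an ordering $\sigma$, a triple $(a,b,c)$ with $a<_\sigma b<_\sigma c$, $ac\in E$, $ab\notin E$ is good if there is a vertex $d$ with $a<_\sigma d<_\sigma b$, $db\in E$, $dc\notin E$, and bad otherwise; $\sigma$ is an LDFS ordering if it has no bad triple. Vertices are indexed by position in $\sigma$; $u_{n+1}$ is adjacent to no vertex. For indices $i,j$: if $i>j$, $G(i,j)$ is empty; if $i\le j$, $G(i,j)$ is the subgraph of $G$ induced by $\{u_i,\dots,u_j\}\setminus N(u_{j+1})$.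 A path $P=(v_1,\dots,v_k)$ of a subgraph $H$ is normal (w.r.t. $\sigma$) if $v_1$ is the rightmost vertex of $V(P)$ in $\sigma$ and, for every $i=2,\dots,k$, $v_i$ is the rightmost vertex of $N(v_{i-1})\cap\{v_i,v_{i+1},\dots,v_k\}$ in $\sigma$. -}

module Defs where

open import Level using (0ℓ) renaming (suc to lsuc)
open import Data.Nat using (ℕ; zero; suc; _≤_; _<_)
open import Data.List using (List; []; _∷_; _++_; _∷ʳ_)
open import Data.List.Membership.Propositional using (_∈_)
open import Data.List.Relation.Unary.All using (All)
open import Data.List.Relation.Unary.Unique.Propositional using (Unique)
open import Data.List.Relation.Unary.Linked using (Linked)
open import Data.Product using (Σ; _×_; ∃)
open import Data.Sum using (_⊎_)
open import Data.Unit using (⊤)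
open import Relation.Nullary using (¬_; Dec)
open import Relation.Binary.PropositionalEquality using (_≡_)

-- Vertices are
-- identified with their positions in the ordering σ, i.e. vertex k is u_k,
-- and σ is the natural order on ℕ.  The number n+1 plays the role of the
-- dummy isolated vertex u_{n+1} (indeed no number outside 1..n has any
-- neighbour).
record Graph (n : ℕ) : Set₁ where
  field
    Adj       : ℕ → ℕ → Set
    Adj?      : ∀ a b → Dec (Adj a b)
    sym       : ∀ {a b} → Adj a b → Adj b a
    irrefl    : ∀ {a} → ¬ Adj a a
    support   : ∀ {a b} → Adj a b → (1 ≤ a × a ≤ n)
open Graph public

module _ {n : ℕ} (G : Graph n) where

  InV : ℕ → Set
  InV a = 1 ≤ a × a ≤ n

  IsCocomparability : Set₁
  IsCocomparability =
    Σ (ℕ → ℕ → Set) λ R →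
        (∀ a b → InV a → InV b → ¬ a ≡ b → ¬ Adj G a b → R a b ⊎ R b a)
      × (∀ {a b} → R a b → InV a × InV b × ¬ a ≡ b × ¬ Adj G a b × ¬ R b a)
      × (∀ {a b c} → R a b → R b c → R a c)

  UmbrellaFree : Set
  UmbrellaFree = ∀ x y z → x < y → y < z → Adj G x z → Adj G x y ⊎ Adj G y z

  IsLDFS : Set
  IsLDFS = ∀ a b c → a < b → b < c → Adj G a c → ¬ Adj G a b →
           ∃ λ d → a < d × d < b × Adj G d b × ¬ Adj G d c

  InG : ℕ → ℕ → ℕ → Set
  InG i j k = i ≤ k × k ≤ j × ¬ Adj G k (suc j)

  IsPathIn : ℕ → ℕ → List ℕ → Set
  IsPathIn i j P = ¬ P ≡ [] × Unique P × All (InG i j) P × Linked (Adj G) P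

  NormalSteps : List ℕ → Set
  NormalSteps [] = ⊤
  NormalSteps (v ∷ []) = ⊤
  NormalSteps (u ∷ v ∷ rest) =
    (∀ w → w ∈ (v ∷ rest) → Adj G u w → w ≤ v) × NormalSteps (v ∷ rest)

  HeadMax : List ℕ → Set
  HeadMax [] = ⊤
  HeadMax (v ∷ rest) = All (λ w → w ≤ v) rest

  IsNormalPathIn : ℕ → ℕ → List ℕ → Set
  IsNormalPathIn i j P = IsPathIn i j P × HeadMax P × NormalSteps P

LastVertex : List ℕ → ℕ → Set
LastVertex P x = ∃ λ xs → P ≡ xs ∷ʳ x

-- Every vertex u of P₁ before x is right of x or adjacent to x: the head is right of x, and if a
-- normal step u → v lands left of x although u is right of x, the umbrella v < x < u gives vx or xu,
-- and xu is excluded by normality at u.  The vertices w of P₂ lie left of x and are not adjacent to x,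
-- so the umbrella w < x < u turns an edge uw into an edge ux; normality at u then keeps u's successor
-- right of x > w, so P₁ stays normal when i and P₂ are appended.  The umbrella i < w < x over the edge
-- ix makes i adjacent to every vertex of P₂.
module Submission where

open import Defs
open import Data.Nat using (ℕ; suc; _≤_; _<_; _∸_; s≤s)
open import Data.Nat.Properties using (≤-refl; ≤-trans; <⇒≤; <-cmp; <-irrefl; <-asym; <⇒≢; ≤∧≢⇒<; <⇒≱)
open import Data.List using (List; []; _∷_; _++_; [_]; _∷ʳ_)
open import Data.List.Properties using (++-assoc; ++-conicalʳ)
open import Data.List.Membership.Propositional using (_∈_)
open import Data.List.Membership.Propositional.Properties using (∈-++⁺ʳ; ∈-++⁻)
open import Data.List.Relation.Unary.Any using (here; there)
open import Data.List.Relation.Unary.All as All using (All; []; _∷_)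
open import Data.List.Relation.Unary.All.Properties as All using ()
open import Data.List.Relation.Unary.AllPairs using (_∷_)
open import Data.List.Relation.Unary.Unique.Propositional using (Unique)
open import Data.List.Relation.Unary.Unique.Propositional.Properties as Unique using ()
open import Data.List.Relation.Unary.Linked using (Linked; [-]; _∷_)
open import Function using (_∘_)
open import Data.Product using (_×_; _,_; proj₁; proj₂)
open import Data.Sum using (_⊎_; inj₁; inj₂; map₁)
open import Relation.Nullary using (¬_; contradiction)
open import Relation.Binary.Definitions using (tri<; tri≈; tri>)
open import Relation.Binary.PropositionalEquality using (_≡_; refl; _≢_; ≢-sym)
import Relation.Binary.PropositionalEquality as ≡

∈-∷ʳ : ∀ {A : Set} (xs : List A) x → x ∈ xs ∷ʳ x
∈-∷ʳ xs x = ∈-++⁺ʳ xs (here refl)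

linked-∷ʳ-++ : ∀ {A : Set} {R : A → A → Set} xs {x} ys →
               Linked R (xs ∷ʳ x) → Linked R (x ∷ ys) → Linked R (xs ∷ʳ x ++ ys)
linked-∷ʳ-++ []           ys _             l = l
linked-∷ʳ-++ (u ∷ [])     ys (ux ∷ [-])    l = ux ∷ l
linked-∷ʳ-++ (u ∷ v ∷ xs) ys (uv ∷ luvxs)  l = uv ∷ linked-∷ʳ-++ (v ∷ xs) ys luvxs l

module _ {n : ℕ} (G : Graph n) where

  headMax-++ : ∀ {x} P R → HeadMax G P → x ∈ P → All (_≤ x) R → HeadMax G (P ++ R)
  headMax-++ (h ∷ t) R hm x∈P R≤x = All.++⁺ hm (All.map (λ w≤x → ≤-trans w≤x (v≤h x∈P)) R≤x)
    where
      v≤h : ∀ {v} → v ∈ h ∷ t → v ≤ h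
      v≤h (here refl) = ≤-refl
      v≤h (there v∈t) = All.lookup hm v∈t

  headMax⇒normalSteps-∷ : ∀ u P → HeadMax G P → NormalSteps G P → ¬ P ≡ [] → NormalSteps G (u ∷ P)
  headMax⇒normalSteps-∷ u []      _  _  P≢[] = contradiction refl P≢[]
  headMax⇒normalSteps-∷ u (h ∷ t) hm ns _    = bounded , ns
    where
      bounded : ∀ w → w ∈ h ∷ t → Adj G u w → w ≤ h
      bounded w (here refl) _ = ≤-refl
      bounded w (there w∈t) _ = All.lookup hm w∈t

  normalStep-++ : ∀ {u v x} rest R → x ∈ v ∷ rest →
    (∀ w → w ∈ v ∷ rest → Adj G u w → w ≤ v) →
    (∀ {w} → w ∈ R → Adj G u w → All (w ≤_) (v ∷ rest) ⊎ (w ≤ x × Adj G u x)) →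
    ∀ w → w ∈ v ∷ rest ++ R → Adj G u w → w ≤ v
  normalStep-++ {v = v} rest R x∈ normal cross w w∈ u~w with ∈-++⁻ (v ∷ rest) w∈
  ... | inj₁ w∈rest = normal w w∈rest u~w
  ... | inj₂ w∈R with cross w∈R u~w
  ...   | inj₁ (w≤v ∷ _)   = w≤v
  ...   | inj₂ (w≤x , u~x) = ≤-trans w≤x (normal _ x∈ u~x)

  -- In the second case normality at u puts u's successor right of x, hence right of w.
  normalSteps-∷ʳ-++ : ∀ xs {x} R → NormalSteps G (xs ∷ʳ x) → NormalSteps G (x ∷ R) →
    (∀ {u w} → u ∈ xs → w ∈ R → Adj G u w → All (w ≤_) (xs ∷ʳ x) ⊎ (w ≤ x × Adj G u x)) →
    NormalSteps G (xs ∷ʳ x ++ R)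
  normalSteps-∷ʳ-++ [] R _ nsR _ = nsR
  normalSteps-∷ʳ-++ (u ∷ []) R (normal , _) nsR cross =
    normalStep-++ [] R (here refl) normal (λ w∈R u~w → map₁ All.tail (cross (here refl) w∈R u~w)) ,
    nsR
  normalSteps-∷ʳ-++ (u ∷ v ∷ xs) {x} R (normal , ns) nsR cross =
    normalStep-++ (xs ∷ʳ x) R (there (∈-∷ʳ xs x)) normal
      (λ w∈R u~w → map₁ All.tail (cross (here refl) w∈R u~w)) ,
    normalSteps-∷ʳ-++ (v ∷ xs) R ns nsR
      (λ u∈ w∈R u~w → map₁ All.tail (cross (there u∈) w∈R u~w))

linked-∷ : ∀ {A : Set} {R : A → A → Set} {u} P → All (R u) P → Linked R P → Linked R (u ∷ P)
linked-∷ []      _         _ = [-]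
linked-∷ (_ ∷ _) (u~h ∷ _) l = u~h ∷ l

module _ {n : ℕ} (G : Graph n) where

  InG-suc : ∀ {i j w} → InG G (suc i) j w → InG G i j w
  InG-suc (i<w , w≤j , w≁) = <⇒≤ i<w , w≤j , w≁

  LeftNonNeighbour : ℕ → ℕ → Set
  LeftNonNeighbour x w = w < x × ¬ Adj G w x

  InG-∸1 : ∀ {i x w} → suc i ≤ x → InG G (suc i) (x ∸ 1) w → suc i ≤ w × LeftNonNeighbour x w
  InG-∸1 {x = suc _} _ (i<w , w≤x-1 , w≁x) = i<w , s≤s w≤x-1 , w≁x

  AboveOrAdj : ℕ → ℕ → Set
  AboveOrAdj x v = x < v ⊎ Adj G v x

  leftNonNeighbour⇒¬aboveOrAdj : ∀ {x v} → LeftNonNeighbour x v → ¬ AboveOrAdj x v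
  leftNonNeighbour⇒¬aboveOrAdj (v<x , _)   (inj₁ x<v) = <-asym v<x x<v
  leftNonNeighbour⇒¬aboveOrAdj (_   , v≁x) (inj₂ v~x) = v≁x v~x

module _ {n : ℕ} (G : Graph n) (uf : UmbrellaFree G) where

  umbrella-right : ∀ {x y z} → x < y → y < z → Adj G x z → ¬ Adj G x y → Adj G y z
  umbrella-right x<y y<z x~z x≁y with uf _ _ _ x<y y<z x~z
  ... | inj₁ x~y = contradiction x~y x≁y
  ... | inj₂ y~z = y~z

  umbrella-left : ∀ {x y z} → x < y → y < z → Adj G x z → ¬ Adj G y z → Adj G x y
  umbrella-left x<y y<z x~z y≁z with uf _ _ _ x<y y<z x~z
  ... | inj₁ x~y = x~y
  ... | inj₂ y~z = contradiction y~z y≁z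

  aboveOrAdj-step : ∀ {x u v} → v ≢ x → Adj G u v → (Adj G u x → x ≤ v) →
                    AboveOrAdj G x u → AboveOrAdj G x v
  aboveOrAdj-step v≢x _ normal (inj₂ u~x) = inj₁ (≤∧≢⇒< (normal u~x) (≢-sym v≢x))
  aboveOrAdj-step {x} {u} {v} v≢x u~v normal (inj₁ x<u) with <-cmp v x
  ... | tri< v<x _ _ with uf v x u v<x x<u (sym G u~v)
  ...   | inj₁ v~x = inj₂ v~x
  ...   | inj₂ x~u = contradiction (normal (sym G x~u)) (<⇒≱ v<x)
  aboveOrAdj-step v≢x _ _ (inj₁ _) | tri≈ _ v≡x _ = contradiction v≡x v≢x
  aboveOrAdj-step _   _ _ (inj₁ _) | tri> _ _ x<v = inj₁ x<v

  aboveOrAdj-path : ∀ {x} u xs → Unique (u ∷ xs ∷ʳ x) → Linked (Adj G) (u ∷ xs ∷ʳ x) →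
                    NormalSteps G (u ∷ xs ∷ʳ x) → AboveOrAdj G x u → All (AboveOrAdj G x) (u ∷ xs)
  aboveOrAdj-path u [] _ _ _ u-ok = u-ok ∷ []
  aboveOrAdj-path {x} u (v ∷ xs) (_ ∷ uniq@(v∉ ∷ _)) (u~v ∷ lk) (normal , ns) u-ok =
    u-ok ∷ aboveOrAdj-path v xs uniq lk ns
      (aboveOrAdj-step (All.lookup v∉ (∈-∷ʳ xs x)) u~v (normal x (there (∈-∷ʳ xs x))) u-ok)

  aboveOrAdj-normalPath : ∀ {i j x} xs → IsNormalPathIn G i j (xs ∷ʳ x) → All (AboveOrAdj G x) xs
  aboveOrAdj-normalPath []      _ = []
  aboveOrAdj-normalPath {x = x} (h ∷ t) ((_ , uniq@(h∉ ∷ _) , _ , lk) , hm , ns) =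
    aboveOrAdj-path h t uniq lk ns
      (inj₁ (≤∧≢⇒< (All.lookup hm (∈-∷ʳ t x)) (≢-sym (All.lookup h∉ (∈-∷ʳ t x)))))

  aboveOrAdj⇒adj : ∀ {x u w} → AboveOrAdj G x u → LeftNonNeighbour G x w → Adj G u w → Adj G u x
  aboveOrAdj⇒adj (inj₂ u~x) _ _ = u~x
  aboveOrAdj⇒adj (inj₁ x<u) (w<x , w≁x) u~w = sym G (umbrella-right w<x x<u (sym G u~w) w≁x)

  InG-below : ∀ {i j x w} → InG G (suc i) j x → InG G (suc i) (x ∸ 1) w → InG G i j w
  InG-below x∈@(i<x , x≤j , x≁) w∈ with InG-∸1 G i<x w∈
  ... | i<w , w<x , w≁x =
    <⇒≤ i<w , ≤-trans (<⇒≤ w<x) x≤j , λ w~ → x≁ (umbrella-right w<x (s≤s x≤j) w~ w≁x)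

  normalPath-join : ∀ {i j x} xs P → InG G i j i → InG G (suc i) j x → Adj G i x →
    IsNormalPathIn G (suc i) j (xs ∷ʳ x) → IsNormalPathIn G (suc i) (x ∸ 1) P →
    IsNormalPathIn G i j (xs ∷ʳ x ++ i ∷ P)
  normalPath-join {i} {x = x} xs P i∈ x∈@(i<x , _) i~x
    path₁@((_ , uniq₁ , in₁ , lk₁) , hm₁ , ns₁) ((P≢[] , uniq₂ , in₂ , lk₂) , hm₂ , ns₂) =
    ( (λ e → contradiction (++-conicalʳ (xs ∷ʳ x) (i ∷ P) e) λ ())
    , Unique.++⁺ uniq₁ (All.map (<⇒≢ ∘ proj₁) bounds ∷ uniq₂) disjoint
    , All.++⁺ (All.map (InG-suc G) in₁) (i∈ ∷ All.map (InG-below x∈) in₂)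
    , linked-∷ʳ-++ xs (i ∷ P) lk₁ (sym G i~x ∷ linked-∷ P (All.map i-sees bounds) lk₂) )
    , headMax-++ G (xs ∷ʳ x) (i ∷ P) hm₁ (∈-∷ʳ xs x) (<⇒≤ i<x ∷ All.map (<⇒≤ ∘ proj₁) left)
    , normalSteps-∷ʳ-++ G xs (i ∷ P) ns₁ (x-step , headMax⇒normalSteps-∷ G i P hm₂ ns₂ P≢[]) cross
    where
      bounds : All (λ w → suc i ≤ w × LeftNonNeighbour G x w) P
      bounds = All.map (InG-∸1 G i<x) in₂

      left : All (LeftNonNeighbour G x) P
      left = All.map proj₂ bounds

      above : All (AboveOrAdj G x) xs
      above = aboveOrAdj-normalPath xs path₁

      i-sees : ∀ {w} → suc i ≤ w × LeftNonNeighbour G x w → Adj G i w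
      i-sees (i<w , w<x , w≁x) = umbrella-left i<w w<x i~x w≁x

      disjoint : ∀ {v} → ¬ (v ∈ xs ∷ʳ x × v ∈ i ∷ P)
      disjoint (i∈₁ , here refl) = <⇒≢ (proj₁ (All.lookup in₁ i∈₁)) refl
      disjoint (v∈₁ , there v∈P) with ∈-++⁻ xs v∈₁
      ... | inj₁ v∈xs        = leftNonNeighbour⇒¬aboveOrAdj G (All.lookup left v∈P) (All.lookup above v∈xs)
      ... | inj₂ (here refl) = <-irrefl refl (proj₁ (All.lookup left v∈P))

      x-step : ∀ w → w ∈ i ∷ P → Adj G x w → w ≤ i
      x-step w (here refl) _   = ≤-refl
      x-step w (there w∈P) x~w = contradiction (sym G x~w) (proj₂ (All.lookup left w∈P))

      cross : ∀ {u w} → u ∈ xs → w ∈ i ∷ P → Adj G u w →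
              All (w ≤_) (xs ∷ʳ x) ⊎ (w ≤ x × Adj G u x)
      cross _ (here refl) _ = inj₁ (All.map (<⇒≤ ∘ proj₁) in₁)
      cross u∈xs (there w∈P) u~w =
        inj₂ (<⇒≤ (proj₁ (All.lookup left w∈P)) ,
              aboveOrAdj⇒adj (All.lookup above u∈xs) (All.lookup left w∈P) u~w)

lastVertex-++ : ∀ P {Q y} → LastVertex Q y → LastVertex (P ++ Q) y
lastVertex-++ P {y = y} (ys , refl) = P ++ ys , ≡.sym (++-assoc P ys [ y ])

lemma11 : (n : ℕ) (G : Graph n) → IsCocomparability G → UmbrellaFree G → IsLDFS G →
          (i j x y : ℕ) → 1 ≤ i → i ≤ n → 1 ≤ j → j ≤ n →
          InG G i j i → InG G (suc i) j x → InG G (suc i) (x ∸ 1) y → Adj G i x →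
          (P₁ P₂ : List ℕ) →
          IsNormalPathIn G (suc i) j P₁ → LastVertex P₁ x →
          IsNormalPathIn G (suc i) (x ∸ 1) P₂ → LastVertex P₂ y →
          IsNormalPathIn G i j (P₁ ++ i ∷ P₂) × LastVertex (P₁ ++ i ∷ P₂) y
lemma11 n G _ uf _ i j x y _ _ _ _ i∈ x∈ _ i~x P₁ P₂ normal₁ (xs , refl) normal₂ last₂ =
  normalPath-join G uf xs P₂ i∈ x∈ i~x normal₁ normal₂ ,
  lastVertex-++ P₁ (lastVertex-++ [ i ] last₂)
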